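{- Let $\mathcal{T}=(T,\sigma,1)$ be $w$-sequentially non-deterministic, with essential POCs $Y=\{\vec y_1,\ldots,\vec y_r\}$ and corresponding starting points $\vec x_1,\ldots,\vec x_r$. Let $i\in\mathbb{Z}^+$. For every $\mathcal{T}$-producing assembly sequence $\vec\beta$, if $Y\subseteq\mathrm{dom}\,\mathrm{res}(\vec\beta)$ and $1\le i\le r$, then $\vec x_i\in\mathrm{dom}\,\mathrm{res}(\vec\beta)$ and $\mathrm{index}_{\vec\beta}(\vec x_i)<\mathrm{index}_{\vec\beta}(\vec y_i)$.
   Context: aTAM at temperature 1: tile types are unit squares with glues (label, strength) on their sides; a configuration is a partial map $\alpha:\mathbb{Z}^2\dashrightarrow T$; adjacent tiles bind if facing glues are equal with positive strength; $G^b_\alpha$ is the binding graph. $\alpha,\beta$ agree if equal on common domain. $\beta=\alpha+(\vec p,t)$ denotes a valid attachment step; if the new tile binds with total strength 1 to the tile at $\vec p\,'$, write $\vec u_{\beta\setminus\alpha}=\vec p\,'-\vec p$. A $\mathcal{T}$-assembly sequence is a finite or infinite sequence $(\beta_1,\beta_2,\ldots)$ of assemblies each obtained from the previous one by a valid attachment step; $\mathcal{T}$-producing if $\beta_1=\sigma$; $\mathrm{res}$ is its result (union); $\mathrm{index}_{\vec\beta}(\vec p)=\min\{i:\vec p\in\mathrm{dom}\,\beta_i\}$. $\mathcal{A}[\mathcal{T}]$: producible assemblies; terminal = no tile can attach. $\mathcal{T}$ is singly seeded with seed point $\vec s$. Competing paths/POCs: for $\vec x\ne\vec y$ and finite simple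 grid paths $\pi,\pi'$ from $\vec x$ to $\vec y$, they compete for $\vec y$ from $\vec x$ if (1) $\pi\ne\pi'$; (2) $\mathrm{dom}\,\pi\cap\mathrm{dom}\,\pi'=\{\vec x,\vec y\}$; (3) one of them is a simple path in $G^b_\alpha$ for some $\alpha\in\mathcal{A}[\mathcal{T}]$; (4) for all $\alpha\in\mathcal{A}[\mathcal{T}]$, $p\in\{\pi,\pi'\}$, $1\le l<|p|$, and simple paths $p'$ from $\vec s$ to $p[l]$ in $G^b_\alpha$: if $p'$ goes through $p[1]$ then $p[1..l]$ is a suffix of $p'$, else $p'$ is a prefix of every simple path from $\vec s$ to $p[1]$ in $G^b_\alpha$; (5) for all $\alpha\in\mathcal{A}[\mathcal{T}]$ every simple path from $\vec s$ to $\vec y$ in $G^b_\alpha$ has $\pi$ or $\pi'$ as a suffix; (6) for all $\alpha\in\mathcal{A}[\mathcal{T}]$ with $\vec x\in\mathrm{dom}\,\alpha$: (a) for each $p\in\{\pi,\pi'\}$ some attachment sequence starting from $\{(\vec x,\alpha(\vec x))\}$ ends with an assembly of domain $\mathrm{dom}\,p$, (b) every attachment sequence starting from $\{(\vec x,\alpha(\vec x))\}$ has only $\pi,\pi'$ as simple paths from $\vec x$ to $\vec y$ in the binding graph of its final assembly. $\vec y$ is a point of competition (POC) with starting point $\vec x$ if such $\pi,\pi'$ exist; $P$ is the set of POCs and $S_P$ the set of their starting points. $w$-correctness: for an $r$-element $Y\subseteq P$ and $w:Y\to T$, $\alpha$ is $w$-correct if $\alpha(\vec p)=w(\vec p)$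 on $\mathrm{dom}\,\alpha\cap Y$ and $\mathrm{dom}\,\alpha\cap(P\setminus Y)=\emptyset$. Directional determinism: $\vec p$ is directionally deterministic if it is $\vec s$ or for all $\alpha,\beta\in\mathcal{A}[\mathcal{T}]$, $t_\alpha,t_\beta$ with $\alpha'=\alpha+(\vec p,t_\alpha)$, $\beta'=\beta+(\vec p,t_\beta)$ valid: if $\vec p\in P$ and $t_\alpha\ne t_\beta$ then $\vec u_{\alpha'\setminus\alpha}\ne\vec u_{\beta'\setminus\beta}$ or $\alpha(\vec p+\vec u_{\alpha'\setminus\alpha})\ne\beta(\vec p+\vec u_{\beta'\setminus\beta})$; if $\vec p\notin P$ and $t_\alpha\ne t_\beta$ then $\alpha,\beta$ do not agree. $\mathcal{T}$ is directionally deterministic if all points of all producible assemblies are. $w$-sequential non-determinism: $\mathcal{T}$ has a nonempty (possibly infinite) set $P$ of POCs with $|P|\ge r$, $Y=\{\vec y_1,\ldots,\vec y_r\}\subseteq P$ with starting points $\vec x_1,\ldots,\vec x_r$, $w:Y\to T$ such that there is a unique $w$-correct $\mathcal{T}$-terminal assembly $\alpha$, and $Y\subseteq\mathrm{dom}\,\alpha$; and (1) $\mathcal{T}$ is directionally deterministic, (2) for every $\mathcal{T}$-producing $\vec\alpha$ with $Y\subseteq\mathrm{dom}\,\mathrm{res}(\vec\alpha)$, $\mathrm{index}(\vec y_i)<\mathrm{index}(\vec y_{i+1})$ for $1\le i<r$, (3) $S_P\cap P=\emptyset$. -}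

module Defs where

open import Data.Nat using (ℕ; zero; suc; _+_; _≤_; _<_; _∸_; _≡ᵇ_)
open import Data.Integer as ℤ using (ℤ)
open import Data.Fin using (Fin; toℕ)
open import Data.Bool using (Bool; true; false; if_then_else_; _∧_)
open import Data.Maybe using (Maybe; just; nothing)
open import Data.Product using (Σ; Σ-syntax; ∃; _×_; _,_; proj₂)
open import Data.Sum using (_⊎_)
open import Data.Unit using (⊤)
open import Data.Empty using (⊥)
open import Data.List using (List; []; _∷_; _++_; length; take; head; last)
open import Data.List.Membership.Propositional using (_∈_)
open import Data.List.Relation.Unary.All using (All)
open import Data.List.Relation.Unary.Linked using (Linked)
open import Data.List.Relation.Unary.Unique.Propositional using (Unique)
open import Relation.Nullary using (¬_; Dec; yes; no)
open import Relation.Binary.PropositionalEquality using (_≡_; _≢_)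
import Data.Product.Properties as ×P

Point : Set
Point = ℤ × ℤ

_+ᵖ_ : Point → Point → Point
(a , b) +ᵖ (c , d) = (a ℤ.+ c , b ℤ.+ d)

_≟ᵖ_ : (p q : Point) → Dec (p ≡ q)
_≟ᵖ_ = ×P.≡-dec ℤ._≟_ ℤ._≟_

data Dir : Set where
  N E S W : Dir

vec : Dir → Point
vec N = (ℤ.0ℤ , ℤ.1ℤ)
vec E = (ℤ.1ℤ , ℤ.0ℤ)
vec S = (ℤ.0ℤ , ℤ.-1ℤ)
vec W = (ℤ.-1ℤ , ℤ.0ℤ)

opp : Dir → Dir
opp N = S
opp E = W
opp S = N
opp W = E

-- a glue is a pair (label , strength)
Glue : Set
Glue = ℕ × ℕ

-- The temperature is fixed to 1.

record TAS : Set where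
  field
    nT       : ℕ
    glue     : Fin nT → Dir → Glue
    seedTile : Fin nT
    seedPt   : Point

  Tile : Set
  Tile = Fin nT

module _ (𝒯 : TAS) where
  open TAS 𝒯

  Config : Set
  Config = Point → Maybe Tile

  InDom : Config → Point → Set
  InDom α p = Σ Tile λ t → α p ≡ just t

  Agree : Config → Config → Set
  Agree α β = ∀ q t₁ t₂ → α q ≡ just t₁ → β q ≡ just t₂ → t₁ ≡ t₂

  σ : Config
  σ q with q ≟ᵖ seedPt
  ... | yes _ = just seedTile
  ... | no  _ = nothing

  str : Config → Point → Tile → Dir → ℕ
  str α p t d with α (p +ᵖ vec d)
  ... | nothing = 0
  ... | just t' with glue t d | glue t' (opp d)
  ...   | (l₁ , s₁) | (l₂ , s₂) = if (l₁ ≡ᵇ l₂) ∧ (s₁ ≡ᵇ s₂) then s₁ else 0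

  totalStr : Config → Point → Tile → ℕ
  totalStr α p t = str α p t N + str α p t E + str α p t S + str α p t W

  Attachable : Config → Point → Tile → Set
  Attachable α p t = (α p ≡ nothing) × (1 ≤ totalStr α p t)

  Step : Config → Config → Point → Tile → Set
  Step α β p t = Attachable α p t × (β p ≡ just t) × (∀ q → q ≢ p → β q ≡ α q)

  -- u_{α'∖α} = d : the tile t attached at p binds with total strength 1,
  -- to the tile at p + vec d
  UDir : Config → Point → Tile → Dir → Set
  UDir α p t d = (totalStr α p t ≡ 1) × (0 < str α p t d)

  data Producible : Config → Set where
    seed   : ∀ {α} → (∀ q → α q ≡ σ q) → Producible α
    attach : ∀ {α β p t} → Producible α → Step α β p t → Producible β

  Terminal : Config → Set
  Terminal α = ∀ p t → ¬ Attachable α p t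

  -- len = just n : n attachment steps (assemblies asm 0 … asm n);
  -- len = nothing : infinite sequence
  InRange : Maybe ℕ → ℕ → Set
  InRange nothing  i = ⊤
  InRange (just n) i = i ≤ n

  record Seq : Set where
    field
      asm   : ℕ → Config
      len   : Maybe ℕ
      valid : ∀ i → InRange len (suc i) →
              Σ Point λ p → Σ Tile λ t → Step (asm i) (asm (suc i)) p t
  open Seq public

  StartsWith : Seq → Config → Set
  StartsWith b c = ∀ q → asm b 0 q ≡ c q

  Producing : Seq → Set
  Producing b = StartsWith b σ

  InDomRes : Seq → Point → Set
  InDomRes b p = Σ ℕ λ i → InRange (len b) i × InDom (asm b i) p

  IsIndex : Seq → Point → ℕ → Set
  IsIndex b p i = InRange (len b) i × InDom (asm b i) p ×
                  (∀ j → j < i → ¬ InDom (asm b j) p)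

  IndexLt : Seq → Point → Point → Set
  IndexLt b p q = Σ ℕ λ i → Σ ℕ λ j → IsIndex b p i × IsIndex b q j × i < j

  FinalIs : Seq → Config → Set
  FinalIs b fin = Σ ℕ λ n → (len b ≡ just n) × (∀ q → asm b n q ≡ fin q)

  Adj : Point → Point → Set
  Adj q q' = Σ Dir λ d → q' ≡ q +ᵖ vec d

  BEdge : Config → Point → Point → Set
  BEdge α q q' = Σ Dir λ d → (q' ≡ q +ᵖ vec d) ×
    Σ Tile λ t₁ → Σ Tile λ t₂ → (α q ≡ just t₁) × (α q' ≡ just t₂) ×
      (glue t₁ d ≡ glue t₂ (opp d)) × (0 < proj₂ (glue t₁ d))

  SimpleGridPath : List Point → Set
  SimpleGridPath π = Linked Adj π × Unique π

  SimpleBPath : Config → List Point → Set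
  SimpleBPath α π = Linked (BEdge α) π × Unique π × All (InDom α) π

  Ends : List Point → Point → Point → Set
  Ends π x y = (head π ≡ just x) × (last π ≡ just y)

  Suffix Prefix : List Point → List Point → Set
  Suffix q p = Σ (List Point) λ r → r ++ q ≡ p
  Prefix q p = Σ (List Point) λ r → q ++ r ≡ p

  -- 1-indexed lookup p[l]
  at : List Point → ℕ → Maybe Point
  at []      _             = nothing
  at (a ∷ _) (suc zero)    = just a
  at (_ ∷ p) (suc (suc l)) = at p (suc l)
  at (_ ∷ _) zero          = nothing

  Cond4 : Point → List Point → Set
  Cond4 x p = ∀ α → Producible α → ∀ l → 1 ≤ l → l < length p →
    ∀ z → at p l ≡ just z →
    ∀ p' → SimpleBPath α p' → Ends p' seedPt z →
      ((x ∈ p' → Suffix (take l p) p') ×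
       (¬ (x ∈ p') → ∀ p'' → SimpleBPath α p'' → Ends p'' seedPt x → Prefix p' p''))

  Compete : Point → Point → List Point → List Point → Set
  Compete x y π π' =
    (x ≢ y) ×
    SimpleGridPath π × Ends π x y ×
    SimpleGridPath π' × Ends π' x y ×
    (π ≢ π') ×
    (∀ q → ((q ∈ π × q ∈ π') → (q ≡ x ⊎ q ≡ y)) × ((q ≡ x ⊎ q ≡ y) → (q ∈ π × q ∈ π'))) ×
    (Σ Config λ α → Producible α × (SimpleBPath α π ⊎ SimpleBPath α π')) ×
    Cond4 x π × Cond4 x π' ×
    (∀ α → Producible α → ∀ p' → SimpleBPath α p' → Ends p' seedPt y →
       Suffix π p' ⊎ Suffix π' p') ×
    (∀ α → Producible α → ∀ t → α x ≡ just t →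
      ((∀ p → (p ≡ π ⊎ p ≡ π') →
         Σ Seq λ b → StartsWith b (Single x t) ×
           Σ Config λ fin → FinalIs b fin × (∀ q → Iff (InDom fin q) (q ∈ p))) ×
       (∀ b → StartsWith b (Single x t) → ∀ fin → FinalIs b fin →
         ∀ p → SimpleBPath fin p → Ends p x y → p ≡ π ⊎ p ≡ π')))
    where
      Iff : Set → Set → Set
      Iff A B = (A → B) × (B → A)
      Single : Point → Tile → Config
      Single x t q with q ≟ᵖ x
      ... | yes _ = just t
      ... | no  _ = nothing

  POCfrom : Point → Point → Set
  POCfrom x y = Σ (List Point) λ π → Σ (List Point) λ π' → Compete x y π π'

  IsPOC : Point → Set
  IsPOC y = Σ Point λ x → POCfrom x y

  IsStart : Point → Set
  IsStart x = Σ Point λ y → POCfrom x y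

  -- Y = {ys 0 , … , ys (r-1)} and w : Y → T given as w : Fin r → T
  WCorrect : (r : ℕ) → (Fin r → Point) → (Fin r → Tile) → Config → Set
  WCorrect r ys w α =
    (∀ i t → α (ys i) ≡ just t → t ≡ w i) ×
    (∀ p → IsPOC p → (∀ i → p ≢ ys i) → α p ≡ nothing)

  DirDetAt : Point → Set
  DirDetAt p = (p ≡ seedPt) ⊎
    (∀ α β tα tβ → Producible α → Producible β →
       Attachable α p tα → Attachable β p tβ →
       (IsPOC p → tα ≢ tβ → ∀ u₁ u₂ → UDir α p tα u₁ → UDir β p tβ u₂ →
          (u₁ ≢ u₂) ⊎ (α (p +ᵖ vec u₁) ≢ β (p +ᵖ vec u₂))) ×
       (¬ IsPOC p → tα ≢ tβ → ¬ Agree α β))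

  DirDet : Set
  DirDet = ∀ α → Producible α → ∀ p → InDom α p → DirDetAt p

  SeqND : (r : ℕ) → (ys xs : Fin r → Point) → (Fin r → Tile) → Set
  SeqND r ys xs w =
    (Σ Point IsPOC) ×
    (∀ i j → ys i ≡ ys j → i ≡ j) ×
    (∀ i → POCfrom (xs i) (ys i)) ×
    (Σ Config λ α → Producible α × Terminal α × WCorrect r ys w α ×
       (∀ i → InDom α (ys i)) ×
       (∀ β → Producible β → Terminal β → WCorrect r ys w β → ∀ q → β q ≡ α q)) ×
    DirDet ×
    (∀ b → Producing b → (∀ i → InDomRes b (ys i)) →
       ∀ i j → toℕ j ≡ suc (toℕ i) → IndexLt b (ys i) (ys j)) ×
    (∀ p → IsStart p → ¬ IsPOC p)

{-# OPTIONS --safe #-}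
-- At temperature 1 every tile of a producible assembly is joined to the seed by a
-- simple path of its binding graph, since each newly attached tile binds to an
-- earlier one.  By condition (5) of competing paths such a path to the POC y ends
-- with π or π′, so it passes through the starting point x.  Hence x is present in
-- the first assembly of the sequence containing y.  That assembly is not the seed,
-- which has a single tile, and it differs from its predecessor only at y ≠ x, so x
-- was placed strictly earlier.
module Submission where

open import Defs
open import Data.Nat using (ℕ; zero; suc; _≤_; _<_; _+_; z≤n; s≤s; _≡ᵇ_)
open import Data.Nat.Properties
  using (≡ᵇ⇒≡; ≤-trans; n≤1+n; n<1+n; n≮0; m≤n⇒m≤1+n; m<1+n⇒m<n∨m≡n; <⇒≤pred)
import Data.Integer as ℤ
import Data.Integer.Properties as ℤ
open import Data.Fin using (Fin)
open import Data.Bool using (true; false; T)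
open import Data.Unit using (tt)
open import Data.Maybe using (just; nothing)
open import Data.Maybe.Relation.Binary.Connected using (Connected; just)
open import Data.Product using (Σ; ∃; _×_; _,_; proj₂)
open import Data.Sum using (_⊎_; inj₁; inj₂)
open import Data.List using (List; []; _∷_; _++_; _∷ʳ_; head; last)
open import Data.List.Membership.Propositional using (_∈_; _∉_)
open import Data.List.Membership.Propositional.Properties using (∈-++⁺ʳ)
open import Data.List.Relation.Unary.Any using (here)
open import Data.List.Relation.Unary.All as All using (All; []; _∷_)
import Data.List.Relation.Unary.All.Properties as All
open import Data.List.Relation.Unary.Linked as Linked using (Linked; [-])
import Data.List.Relation.Unary.Linked.Properties as Linked
open import Data.List.Relation.Unary.Unique.Propositional using (Unique; []; _∷_)
import Data.List.Relation.Unary.Unique.Propositional.Properties as Unique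
open import Relation.Nullary using (¬_; Dec; yes; no; contradiction)
open import Relation.Unary using (Decidable)
open import Relation.Binary.PropositionalEquality
open ≡-Reasoning

module _ {P : ℕ → Set} (P? : Decidable P) where

  least-below : ∀ n → (∀ i → i < n → ¬ P i) ⊎ ∃ λ j → j < n × P j × (∀ i → i < j → ¬ P i)
  least-below zero = inj₁ λ _ ()
  least-below (suc n) with least-below n
  ... | inj₂ (j , j<n , pj , minimal) = inj₂ (j , m≤n⇒m≤1+n j<n , pj , minimal)
  ... | inj₁ none with P? n
  ...   | yes pn = inj₂ (n , n<1+n n , pn , none)
  ...   | no ¬pn = inj₁ λ i i<1+n → case (m<1+n⇒m<n∨m≡n i<1+n)
    where
    case : ∀ {i} → i < n ⊎ i ≡ n → ¬ P i
    case (inj₁ i<n)  = none _ i<n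
    case (inj₂ refl) = ¬pn

  least-≤ : ∀ {k} → P k → ∃ λ j → j ≤ k × P j × (∀ i → i < j → ¬ P i)
  least-≤ {k} pk with least-below (suc k)
  ... | inj₁ none = contradiction pk (none k (n<1+n k))
  ... | inj₂ (j , j<1+k , pj , minimal) = j , <⇒≤pred j<1+k , pj , minimal

module _ {A : Set} where

  head≡just⇒∈ : ∀ {x} (xs : List A) → head xs ≡ just x → x ∈ xs
  head≡just⇒∈ (_ ∷ _) refl = here refl

  head-++ : ∀ {x} (xs ys : List A) → head xs ≡ just x → head (xs ++ ys) ≡ just x
  head-++ (_ ∷ _) _ eq = eq

  last-∷ʳ : ∀ (xs : List A) y → last (xs ∷ʳ y) ≡ just y
  last-∷ʳ []           y = refl
  last-∷ʳ (_ ∷ [])     y = refl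
  last-∷ʳ (_ ∷ x ∷ xs) y = last-∷ʳ (x ∷ xs) y

  Linked-∷ʳ : ∀ {R : A → A → Set} {xs x y} →
              Linked R xs → last xs ≡ just x → R x y → Linked R (xs ∷ʳ y)
  Linked-∷ʳ {R} {y = y} linked eq r =
    Linked.++⁺ linked (subst (λ m → Connected R m (just y)) (sym eq) (just r)) [-]

  Unique-∷ʳ : ∀ {xs : List A} {y} → Unique xs → y ∉ xs → Unique (xs ∷ʳ y)
  Unique-∷ʳ unique y∉xs = Unique.++⁺ unique ([] ∷ []) λ { (v∈xs , here refl) → y∉xs v∈xs }

+ᵖ-assoc : ∀ p q r → (p +ᵖ q) +ᵖ r ≡ p +ᵖ (q +ᵖ r)
+ᵖ-assoc (a , b) (c , d) (e , f) = cong₂ _,_ (ℤ.+-assoc a c e) (ℤ.+-assoc b d f)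

+ᵖ-identityʳ : ∀ p → p +ᵖ (ℤ.0ℤ , ℤ.0ℤ) ≡ p
+ᵖ-identityʳ (a , b) = cong₂ _,_ (ℤ.+-identityʳ a) (ℤ.+-identityʳ b)

vec-inverseʳ : ∀ d → vec d +ᵖ vec (opp d) ≡ (ℤ.0ℤ , ℤ.0ℤ)
vec-inverseʳ N = refl
vec-inverseʳ E = refl
vec-inverseʳ S = refl
vec-inverseʳ W = refl

+ᵖ-vec-opp : ∀ p d → (p +ᵖ vec d) +ᵖ vec (opp d) ≡ p
+ᵖ-vec-opp p d = begin
  (p +ᵖ vec d) +ᵖ vec (opp d)  ≡⟨ +ᵖ-assoc p (vec d) (vec (opp d)) ⟩
  p +ᵖ (vec d +ᵖ vec (opp d))  ≡⟨ cong (p +ᵖ_) (vec-inverseʳ d) ⟩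
  p +ᵖ (ℤ.0ℤ , ℤ.0ℤ)           ≡⟨ +ᵖ-identityʳ p ⟩
  p                            ∎

opp-involutive : ∀ d → opp (opp d) ≡ d
opp-involutive N = refl
opp-involutive E = refl
opp-involutive S = refl
opp-involutive W = refl

positive-summand : ∀ a b c e → 1 ≤ a + b + c + e → 0 < a ⊎ 0 < b ⊎ 0 < c ⊎ 0 < e
positive-summand (suc a) b c e _ = inj₁ (s≤s z≤n)
positive-summand zero (suc b) c e _ = inj₂ (inj₁ (s≤s z≤n))
positive-summand zero zero (suc c) e _ = inj₂ (inj₂ (inj₁ (s≤s z≤n)))
positive-summand zero zero zero (suc e) _ = inj₂ (inj₂ (inj₂ (s≤s z≤n)))

≡ᵇ-true⇒≡ : ∀ {m n} → (m ≡ᵇ n) ≡ true → m ≡ n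
≡ᵇ-true⇒≡ {m} {n} eq = ≡ᵇ⇒≡ m n (subst T (sym eq) tt)

module _ (𝒯 : TAS) where
  open TAS 𝒯

  str-pos⇒bond : ∀ α p t d → 0 < str 𝒯 α p t d →
                 Σ Tile λ t′ → α (p +ᵖ vec d) ≡ just t′ ×
                   glue t d ≡ glue t′ (opp d) × 0 < proj₂ (glue t d)
  str-pos⇒bond α p t d pos with α (p +ᵖ vec d)
  ... | nothing = contradiction pos n≮0
  ... | just t′ with glue t d | glue t′ (opp d) in g′
  ...   | (l₁ , s₁) | (l₂ , s₂) with l₁ ≡ᵇ l₂ in l₁≡l₂ | s₁ ≡ᵇ s₂ in s₁≡s₂
  ...     | true  | true  = t′ , refl , trans (cong₂ _,_ (≡ᵇ-true⇒≡ l₁≡l₂) (≡ᵇ-true⇒≡ s₁≡s₂)) (sym g′) , pos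
  ...     | true  | false = contradiction pos n≮0
  ...     | false | _     = contradiction pos n≮0

  totalStr-pos⇒str-pos : ∀ α p t → 1 ≤ totalStr 𝒯 α p t → ∃ λ d → 0 < str 𝒯 α p t d
  totalStr-pos⇒str-pos α p t tot
    with positive-summand (str 𝒯 α p t N) (str 𝒯 α p t E) (str 𝒯 α p t S) (str 𝒯 α p t W) tot
  ... | inj₁ pos               = N , pos
  ... | inj₂ (inj₁ pos)        = E , pos
  ... | inj₂ (inj₂ (inj₁ pos)) = S , pos
  ... | inj₂ (inj₂ (inj₂ pos)) = W , pos

  σ-just⇒seedPt : ∀ {q t} → σ 𝒯 q ≡ just t → q ≡ seedPt
  σ-just⇒seedPt {q} σq with q ≟ᵖ seedPt
  ... | yes q≡s = q≡s
  σ-just⇒seedPt () | no _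

  _⊑_ : Config 𝒯 → Config 𝒯 → Set
  α ⊑ β = ∀ q {t} → α q ≡ just t → β q ≡ just t

  Step⇒⊑ : ∀ {α β p t} → Step 𝒯 α β p t → α ⊑ β
  Step⇒⊑ {p = p} ((αp≡nothing , _) , _ , unchanged) q αq with q ≟ᵖ p
  ... | yes refl = contradiction (trans (sym αp≡nothing) αq) λ ()
  ... | no q≢p   = trans (unchanged q q≢p) αq

  Step-reflects : ∀ {α β p t q} → Step 𝒯 α β p t → q ≢ p → InDom 𝒯 β q → InDom 𝒯 α q
  Step-reflects (_ , _ , unchanged) q≢p (t , βq) = t , trans (sym (unchanged _ q≢p)) βq

  Step-new : ∀ {α β p t q} → Step 𝒯 α β p t → InDom 𝒯 β q → ¬ InDom 𝒯 α q → q ≡ p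
  Step-new {p = p} {q = q} step q∈β q∉α with q ≟ᵖ p
  ... | yes q≡p = q≡p
  ... | no q≢p  = contradiction (Step-reflects step q≢p q∈β) q∉α

  InDom-⊑ : ∀ {α β} → α ⊑ β → ∀ {q} → InDom 𝒯 α q → InDom 𝒯 β q
  InDom-⊑ α⊑β {q} (t , αq) = t , α⊑β q αq

  BEdge-⊑ : ∀ {α β} → α ⊑ β → ∀ {q q′} → BEdge 𝒯 α q q′ → BEdge 𝒯 β q q′
  BEdge-⊑ α⊑β {q} {q′} (d , q′≡ , t₁ , t₂ , αq , αq′ , bond) =
    d , q′≡ , t₁ , t₂ , α⊑β q αq , α⊑β q′ αq′ , bond

  SimpleBPath-⊑ : ∀ {α β} → α ⊑ β → ∀ {π} → SimpleBPath 𝒯 α π → SimpleBPath 𝒯 β π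
  SimpleBPath-⊑ α⊑β (linked , unique , inDom) =
    Linked.map (BEdge-⊑ α⊑β) linked , unique , All.map (InDom-⊑ α⊑β) inDom

  SeedPath : Config 𝒯 → Point → Set
  SeedPath α q = Σ (List Point) λ π → SimpleBPath 𝒯 α π × Ends 𝒯 π seedPt q

  SeedPath-⊑ : ∀ {α β} → α ⊑ β → ∀ {q} → SeedPath α q → SeedPath β q
  SeedPath-⊑ α⊑β (π , path , ends) = π , SimpleBPath-⊑ α⊑β path , ends

  attached-bond : ∀ {α β p t} → Step 𝒯 α β p t →
                  ∃ λ d → InDom 𝒯 α (p +ᵖ vec d) × BEdge 𝒯 β (p +ᵖ vec d) p
  attached-bond {α} {p = p} {t} step@((_ , tot) , βp , _)
    with totalStr-pos⇒str-pos α p t tot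
  ... | d , pos with str-pos⇒bond α p t d pos
  ... | t′ , αq , g , strength =
    d , (t′ , αq) ,
    opp d , sym (+ᵖ-vec-opp p d) , t′ , t , Step⇒⊑ step _ αq , βp ,
    trans (sym g) (cong (glue t) (sym (opp-involutive d))) ,
    subst (λ gl → 0 < proj₂ gl) g strength

  SeedPath-avoids : ∀ {α p q} → α p ≡ nothing → ((π , _) : SeedPath α q) → p ∉ π
  SeedPath-avoids αp≡nothing (_ , (_ , _ , inDom) , _) p∈π with All.lookup inDom p∈π
  ... | _ , αp = contradiction (trans (sym αp≡nothing) αp) λ ()

  SeedPath-∷ʳ : ∀ {α p q} → ((π , _) : SeedPath α q) → p ∉ π → BEdge 𝒯 α q p → SeedPath α p
  SeedPath-∷ʳ {p = p} (π , (linked , unique , inDom) , first , final) p∉π edge@(_ , _ , _ , t , _ , αp , _) =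
    π ∷ʳ p ,
    (Linked-∷ʳ linked final edge , Unique-∷ʳ unique p∉π , All.++⁺ inDom ((t , αp) ∷ [])) ,
    head-++ π (p ∷ []) first , last-∷ʳ π p

  Producible⇒SeedPath : ∀ {α} → Producible 𝒯 α → ∀ {q} → InDom 𝒯 α q → SeedPath α q
  Producible⇒SeedPath (seed α≡σ) {q} (t , αq) with σ-just⇒seedPt (trans (sym (α≡σ q)) αq)
  ... | refl = seedPt ∷ [] , ([-] , [] ∷ [] , (t , αq) ∷ []) , refl , refl
  Producible⇒SeedPath (attach {p = p} prod step@((αp≡nothing , _) , _)) {q} q∈β with q ≟ᵖ p
  ... | no q≢p = SeedPath-⊑ (Step⇒⊑ step) (Producible⇒SeedPath prod (Step-reflects step q≢p q∈β))
  ... | yes refl with attached-bond step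
  ...   | _ , neighbour , edge =
    SeedPath-∷ʳ (SeedPath-⊑ (Step⇒⊑ step) path) (SeedPath-avoids αp≡nothing path) edge
    where path = Producible⇒SeedPath prod neighbour

  InRange-≤ : ∀ l {j k} → j ≤ k → InRange 𝒯 l k → InRange 𝒯 l j
  InRange-≤ nothing  _   _   = tt
  InRange-≤ (just n) j≤k k≤n = ≤-trans j≤k k≤n

  Producing⇒Producible : ∀ b → Producing 𝒯 b → ∀ j → InRange 𝒯 (len b) j → Producible 𝒯 (asm b j)
  Producing⇒Producible b producing zero _ = seed producing
  Producing⇒Producible b producing (suc j) inRange =
    attach (Producing⇒Producible b producing j (InRange-≤ (len b) (n≤1+n j) inRange))
           (proj₂ (proj₂ (valid b j inRange)))

  InDom? : ∀ α q → Dec (InDom 𝒯 α q)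
  InDom? α q with α q
  ... | just t  = yes (t , refl)
  ... | nothing = no λ ()

  index-≤ : ∀ b {k p} → InRange 𝒯 (len b) k → InDom 𝒯 (asm b k) p → ∃ λ i → i ≤ k × IsIndex 𝒯 b p i
  index-≤ b {p = p} inRange p∈ with least-≤ (λ i → InDom? (asm b i) p) p∈
  ... | i , i≤k , p∈ᵢ , minimal = i , i≤k , InRange-≤ (len b) i≤k inRange , p∈ᵢ , minimal

  IndexLt-of-present : ∀ b {x y j} → Producing 𝒯 b → x ≢ y → IsIndex 𝒯 b y j → InDom 𝒯 (asm b j) x →
                       InDomRes 𝒯 b x × IndexLt 𝒯 b x y
  IndexLt-of-present b {j = zero} producing x≢y (_ , (_ , b₀y) , _) (_ , b₀x) =
    contradiction (trans (at-seed b₀x) (sym (at-seed b₀y))) x≢y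
    where
    at-seed : ∀ {q t} → asm b 0 q ≡ just t → q ≡ seedPt
    at-seed {q} b₀q = σ-just⇒seedPt (trans (sym (producing q)) b₀q)
  IndexLt-of-present b {j = suc j} producing x≢y index-y@(inRange , y∈ , minimal) x∈
    with valid b j inRange
  ... | p , _ , step with Step-new step y∈ (minimal j (n<1+n j))
  ... | refl with index-≤ b (InRange-≤ (len b) (n≤1+n j) inRange) (Step-reflects step x≢y x∈)
  ... | i , i≤j , index-x@(inRangeᵢ , x∈ᵢ , _) =
    (i , inRangeᵢ , x∈ᵢ) , (i , suc j , index-x , index-y , s≤s i≤j)

  start∈SeedPath : ∀ {x y α} → POCfrom 𝒯 x y → Producible 𝒯 α → ((π , _) : SeedPath α y) → x ∈ π
  start∈SeedPath {x} (π , π′ , _ , _ , (π-from-x , _) , _ , (π′-from-x , _) , _ , _ , _ , _ , _ , suffix , _)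
                 producible (ρ , path , ends) with suffix _ producible ρ path ends
  ... | inj₁ (r , r++π≡ρ)  = subst (x ∈_) r++π≡ρ  (∈-++⁺ʳ r (head≡just⇒∈ π π-from-x))
  ... | inj₂ (r , r++π′≡ρ) = subst (x ∈_) r++π′≡ρ (∈-++⁺ʳ r (head≡just⇒∈ π′ π′-from-x))

  POC-start-InDom : ∀ {x y α} → POCfrom 𝒯 x y → Producible 𝒯 α → InDom 𝒯 α y → InDom 𝒯 α x
  POC-start-InDom poc producible y∈ with Producible⇒SeedPath producible y∈
  ... | seedPath@(_ , (_ , _ , inDom) , _) = All.lookup inDom (start∈SeedPath poc producible seedPath)

  POC-start-precedes : ∀ b {x y} → Producing 𝒯 b → POCfrom 𝒯 x y → InDomRes 𝒯 b y →
                       InDomRes 𝒯 b x × IndexLt 𝒯 b x y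
  POC-start-precedes b producing poc@(_ , _ , x≢y , _) (_ , inRange , y∈)
    with index-≤ b inRange y∈
  ... | j , _ , index-y@(inRangeⱼ , y∈ⱼ , _) =
    IndexLt-of-present b producing x≢y index-y
      (POC-start-InDom poc (Producing⇒Producible b producing j inRangeⱼ) y∈ⱼ)

lemma4 : (𝒯 : TAS) (r : ℕ) (ys xs : Fin r → Point) (w : Fin r → TAS.Tile 𝒯) →
         SeqND 𝒯 r ys xs w →
         ∀ b → Producing 𝒯 b → (∀ i → InDomRes 𝒯 b (ys i)) →
         ∀ i → InDomRes 𝒯 b (xs i) × IndexLt 𝒯 b (xs i) (ys i)
lemma4 𝒯 r ys xs w (_ , _ , starts , _) b producing ys∈ i =
  POC-start-precedes 𝒯 b producing (starts i) (ys∈ i)
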